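{- Let $N\ge 1$ and let $f$ be a permutation of $\{0,\dots,N-1\}$. Then $f$ can be coded by $4$ lookup tables, each of size at most $N$, such that for every natural number $m$ and every $x\in\{0,\dots,N-1\}$, the value $f^m(x)$ (the $m$-th iterate of $f$ at $x$) can be computed using $5$ invocations (accesses) of these lookup tables and $5$ elementary arithmetic operations (additions, subtractions, or modular reductions); in particular, the number of operations does not depend on $m$.
   Context: A lookup table of size $N$ is an array storing $N$ integer values, each of which can be read by a single access given its index. -}

module Defs where

open import Data.Nat as ℕ using (ℕ; zero; suc)
open import Data.Integer using (ℤ; +_; -[1+_]; _+_; _-_; ∣_∣)
open import Data.Integer.DivMod using (_%ℕ_)
open import Data.Fin using (Fin)
open import Data.List using (List; []; _∷_; _++_; [_]; length)
open import Data.Maybe using (Maybe; just; nothing; _>>=_)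
open import Data.Vec using (Vec)

iter : {A : Set} → (A → A) → ℕ → A → A
iter f zero    a = a
iter f (suc m) a = f (iter f m a)

-- A run starts with the register file [x , m] (register 0 holds x,
-- register 1 holds m); every instruction appends one new register,
-- whose operands refer to earlier registers by index.  The result of
-- a program is the last register.  Any ill-defined step (register
-- out of range, table index out of bounds, modulus by 0) fails.

data Instr (K : ℕ) : Set where
  look : Fin K → ℕ → Instr K
  add  : ℕ → ℕ → Instr K
  sub  : ℕ → ℕ → Instr K
  mod  : ℕ → ℕ → Instr K            -- r₁ mod r₂  (least nonnegative residue mod |r₂|)

Table : Set
Table = List ℤ

nth : {A : Set} → List A → ℕ → Maybe A
nth []       _       = nothing
nth (a ∷ as) zero    = just a
nth (a ∷ as) (suc i) = nth as i

readTable : Table → ℤ → Maybe ℤ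
readTable t (+ i)    = nth t i
readTable t -[1+ _ ] = nothing

modℤ : ℤ → ℤ → Maybe ℤ
modℤ a b with ∣ b ∣
... | zero  = nothing
... | suc n = just (+ (a %ℕ suc n))

step : {K : ℕ} → (Fin K → Table) → Instr K → List ℤ → Maybe ℤ
step T (look t r) env = nth env r >>= readTable (T t)
step T (add r s)  env = nth env r >>= λ a → nth env s >>= λ b → just (a + b)
step T (sub r s)  env = nth env r >>= λ a → nth env s >>= λ b → just (a - b)
step T (mod r s)  env = nth env r >>= λ a → nth env s >>= λ b → modℤ a b

exec : {K : ℕ} → (Fin K → Table) → List (Instr K) → List ℤ → Maybe (List ℤ)
exec T []       env = just env
exec T (i ∷ is) env = step T i env >>= λ v → exec T is (env ++ [ v ])

lastReg : List ℤ → Maybe ℤ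
lastReg []           = nothing
lastReg (a ∷ [])     = just a
lastReg (a ∷ b ∷ as) = lastReg (b ∷ as)

run : {K : ℕ} → (Fin K → Table) → List (Instr K) → ℤ → ℤ → Maybe ℤ
run T p x m = exec T p (x ∷ m ∷ []) >>= lastReg

#lookups : {K : ℕ} → List (Instr K) → ℕ
#lookups []             = 0
#lookups (look _ _ ∷ p) = suc (#lookups p)
#lookups (_ ∷ p)        = #lookups p

#arith : {K : ℕ} → List (Instr K) → ℕ
#arith []             = 0
#arith (look _ _ ∷ p) = #arith p
#arith (_ ∷ p)        = suc (#arith p)

module Submission where

-- Every x lies on a cycle of f of length ℓ(x) ≤ N, so fᵐ(x) = fʳ(x) with r = m mod ℓ(x) < N.
-- The orbit x, f(x), …, f^N(x) is packed into a single number A(x) written in base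
-- B = 2N + 1, whose digits are chosen so that the sum of the lowest r + 1 digits is
-- fʳ(x) + rN.  Since B ≡ 1 (mod N), a numeral is congruent to its digit sum modulo N,
-- hence fʳ(x) = (A(x) mod B^(r+1)) mod N.  The four tables store ℓ(x), B^(r+1), A(x)
-- and the constant N.

open import Defs
open import Data.Nat using (ℕ; _≤_)
open import Data.Integer using (ℤ; +_)
open import Data.Fin using (Fin; toℕ)
open import Data.Fin.Permutation using (Permutation′; _⟨$⟩ʳ_)
open import Data.List using (List; length)
open import Data.Maybe using (just)
open import Data.Product using (Σ; _×_)
open import Relation.Binary.PropositionalEquality using (_≡_)

open import Data.Nat using (zero; suc; _+_; _*_; _∸_; _^_; _<_; _%_; _/_; NonZero; >-nonZero; s≤s)
open import Data.Nat.Properties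
open import Data.Nat.DivMod
open import Data.Fin.Patterns using (0F; 1F; 2F; 3F)
open import Data.Fin.Properties using (toℕ<n; pigeonhole)
open import Data.List using ([]; _∷_; tabulate)
open import Data.List.Properties using (length-tabulate)
open import Data.Product using (_,_)
open import Function.Base using (_∘_)
open import Function.Bundles using (Injection)
open import Function.Definitions using (Injective)
open import Function.Properties.Inverse using (↔⇒↣)
open import Relation.Binary.PropositionalEquality
  using (refl; sym; cong; cong₂; subst; module ≡-Reasoning)

private
  variable
    A : Set
    n : ℕ

nth-tabulate : (f : Fin n → A) (i : Fin n) → nth (tabulate f) (toℕ i) ≡ just (f i)
nth-tabulate {suc n} f Fin.zero    = refl
nth-tabulate {suc n} f (Fin.suc i) = nth-tabulate (λ j → f (Fin.suc j)) i

nth-tabulate-toℕ : (h : ℕ → A) {r : ℕ} → r < n → nth (tabulate {n = n} (h ∘ toℕ)) r ≡ just (h r)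
nth-tabulate-toℕ {n = suc n} h {zero}  _         = refl
nth-tabulate-toℕ {n = suc n} h {suc r} (s≤s r<n) = nth-tabulate-toℕ (h ∘ suc) r<n

modℤ-+ : ∀ a b .{{_ : NonZero b}} → modℤ (+ a) (+ b) ≡ just (+ (a % b))
modℤ-+ a (suc b) = refl

module _ (g : A → A) where

  iter-+ : ∀ k l a → iter g (k + l) a ≡ iter g k (iter g l a)
  iter-+ zero    l a = refl
  iter-+ (suc k) l a = cong g (iter-+ k l a)

  iter-*-fixed : ∀ {ℓ a} q → iter g ℓ a ≡ a → iter g (q * ℓ) a ≡ a
  iter-*-fixed {ℓ} {a} zero    fixed = refl
  iter-*-fixed {ℓ} {a} (suc q) fixed = begin
    iter g (ℓ + q * ℓ) a        ≡⟨ iter-+ ℓ (q * ℓ) a ⟩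
    iter g ℓ (iter g (q * ℓ) a) ≡⟨ cong (iter g ℓ) (iter-*-fixed q fixed) ⟩
    iter g ℓ a                  ≡⟨ fixed ⟩
    a                           ∎
    where open ≡-Reasoning

  iter-%-period : ∀ {ℓ a} .{{_ : NonZero ℓ}} → iter g ℓ a ≡ a → ∀ m → iter g m a ≡ iter g (m % ℓ) a
  iter-%-period {ℓ} {a} fixed m = begin
    iter g m a                            ≡⟨ cong (λ k → iter g k a) (m≡m%n+[m/n]*n m ℓ) ⟩
    iter g (m % ℓ + m / ℓ * ℓ) a          ≡⟨ iter-+ (m % ℓ) (m / ℓ * ℓ) a ⟩
    iter g (m % ℓ) (iter g (m / ℓ * ℓ) a) ≡⟨ cong (iter g (m % ℓ)) (iter-*-fixed (m / ℓ) fixed) ⟩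
    iter g (m % ℓ) a                      ∎
    where open ≡-Reasoning

  iter-injective : Injective _≡_ _≡_ g → ∀ k → Injective _≡_ _≡_ (iter g k)
  iter-injective inj zero    eq = eq
  iter-injective inj (suc k) eq = iter-injective inj k (inj eq)

record Period (g : Fin n → Fin n) (x : Fin n) : Set where
  field
    period         : ℕ
    period-nonZero : NonZero period
    period≤n       : period ≤ n
    iter-period    : iter g period x ≡ x

-- Pigeonhole on x, g x, …, gⁿ x gives gⁱ x ≡ gʲ x with i < j ≤ n; cancel gⁱ.
injective⇒period : {g : Fin n → Fin n} → Injective _≡_ _≡_ g → ∀ x → Period g x
injective⇒period {n} {g} inj x
  with i , j , i<j , gⁱx≡gʲx ← pigeonhole (n<1+n n) (λ k → iter g (toℕ k) x) = record
  { period         = toℕ j ∸ toℕ i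
  ; period-nonZero = >-nonZero (m<n⇒0<n∸m i<j)
  ; period≤n       = ≤-trans (m∸n≤m (toℕ j) (toℕ i)) (≤-pred (toℕ<n j))
  ; iter-period    = iter-injective g inj (toℕ i) (begin
      iter g (toℕ i) (iter g (toℕ j ∸ toℕ i) x) ≡⟨ iter-+ g (toℕ i) (toℕ j ∸ toℕ i) x ⟨
      iter g (toℕ i + (toℕ j ∸ toℕ i)) x        ≡⟨ cong (λ k → iter g k x) (m+[n∸m]≡n (<⇒≤ i<j)) ⟩
      iter g (toℕ j) x                          ≡⟨ gⁱx≡gʲx ⟨
      iter g (toℕ i) x                          ∎)
  }
  where open ≡-Reasoning

digitSum : (ℕ → ℕ) → ℕ → ℕ
digitSum d zero    = d 0
digitSum d (suc r) = digitSum d r + d (suc r)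

module Numeral (B : ℕ) .{{_ : NonZero B}} where

  numeral : (ℕ → ℕ) → ℕ → ℕ
  numeral d zero    = d 0
  numeral d (suc r) = numeral d r + d (suc r) * B ^ suc r

  numeral-< : ∀ {d} → (∀ k → d k < B) → ∀ r → numeral d r < B ^ suc r
  numeral-< {d} d<B zero    = subst (d 0 <_) (sym (*-identityʳ B)) (d<B 0)
  numeral-< {d} d<B (suc r) = begin-strict
    numeral d r + d (suc r) * B ^ suc r <⟨ +-monoˡ-< _ (numeral-< d<B r) ⟩
    suc (d (suc r)) * B ^ suc r         ≤⟨ *-monoˡ-≤ (B ^ suc r) (d<B (suc r)) ⟩
    B * B ^ suc r                       ∎
    where open ≤-Reasoning

  numeral-%-prefix : ∀ {d} → (∀ k → d k < B) → ∀ t r →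
                     let instance _ = m^n≢0 B (suc r) in numeral d (t + r) % B ^ suc r ≡ numeral d r
  numeral-%-prefix d<B zero    r = m<n⇒m%n≡m (numeral-< d<B r)
    where instance _ = m^n≢0 B (suc r)
  numeral-%-prefix {d} d<B (suc t) r = begin
    (numeral d (t + r) + d (suc (t + r)) * B ^ suc (t + r)) % P ≡⟨ cong (λ e → (numeral d (t + r) + e) % P) shift ⟩
    (numeral d (t + r) + (d (suc (t + r)) * B ^ t) * P) % P     ≡⟨ [m+kn]%n≡m%n (numeral d (t + r)) (d (suc (t + r)) * B ^ t) P ⟩
    numeral d (t + r) % P                                       ≡⟨ numeral-%-prefix d<B t r ⟩
    numeral d r                                                 ∎
    where
    open ≡-Reasoning
    instance _ = m^n≢0 B (suc r)
    P = B ^ suc r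
    shift : d (suc (t + r)) * B ^ suc (t + r) ≡ (d (suc (t + r)) * B ^ t) * P
    shift = begin
      d (suc (t + r)) * B ^ suc (t + r) ≡⟨ cong (λ e → d (suc (t + r)) * B ^ e) (+-suc t r) ⟨
      d (suc (t + r)) * B ^ (t + suc r) ≡⟨ cong (d (suc (t + r)) *_) (^-distribˡ-+-* B t (suc r)) ⟩
      d (suc (t + r)) * (B ^ t * P)     ≡⟨ *-assoc (d (suc (t + r))) (B ^ t) P ⟨
      (d (suc (t + r)) * B ^ t) * P     ∎

  module _ (N : ℕ) .{{_ : NonZero N}} (B%N≡1%N : B % N ≡ 1 % N) where

    *-B^-% : ∀ a k → (a * B ^ k) % N ≡ a % N
    *-B^-% a k = begin
      (a * B ^ k) % N           ≡⟨ %-distribˡ-* a (B ^ k) N ⟩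
      (a % N * (B ^ k % N)) % N ≡⟨ cong (λ e → (a % N * e) % N) (B^-% k) ⟩
      (a % N * (1 % N)) % N     ≡⟨ %-distribˡ-* a 1 N ⟨
      (a * 1) % N               ≡⟨ cong (_% N) (*-identityʳ a) ⟩
      a % N                     ∎
      where
      open ≡-Reasoning
      B^-% : ∀ k → B ^ k % N ≡ 1 % N
      B^-% zero    = refl
      B^-% (suc k) = begin
        (B * B ^ k) % N           ≡⟨ %-distribˡ-* B (B ^ k) N ⟩
        (B % N * (B ^ k % N)) % N ≡⟨ cong₂ (λ u w → (u * w) % N) B%N≡1%N (B^-% k) ⟩
        (1 % N * (1 % N)) % N     ≡⟨ %-distribˡ-* 1 1 N ⟨
        1 % N                     ∎

    numeral-%-digitSum : ∀ d r → numeral d r % N ≡ digitSum d r % N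
    numeral-%-digitSum d zero    = refl
    numeral-%-digitSum d (suc r) = begin
      (numeral d r + d (suc r) * B ^ suc r) % N           ≡⟨ %-distribˡ-+ (numeral d r) _ N ⟩
      (numeral d r % N + (d (suc r) * B ^ suc r) % N) % N ≡⟨ cong₂ (λ u w → (u + w) % N) (numeral-%-digitSum d r) (*-B^-% (d (suc r)) (suc r)) ⟩
      (digitSum d r % N + d (suc r) % N) % N              ≡⟨ %-distribˡ-+ (digitSum d r) (d (suc r)) N ⟨
      (digitSum d r + d (suc r)) % N                      ∎
      where open ≡-Reasoning

module Telescoping (N : ℕ) .{{_ : NonZero N}} (v : ℕ → ℕ) (v<N : ∀ k → v k < N) where

  B : ℕ
  B = 1 + 2 * N

  open Numeral B

  -- Adding N keeps the subtraction from truncating; it resurfaces as the term r * N of the digit sum.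
  digit : ℕ → ℕ
  digit zero    = v zero
  digit (suc k) = v (suc k) + N ∸ v k

  digit<B : ∀ k → digit k < B
  digit<B k = m<n⇒m<1+n (subst (digit k <_) (cong (_+_ N) (sym (+-identityʳ N))) (digit<N+N k))
    where
    digit<N+N : ∀ k → digit k < N + N
    digit<N+N zero    = <-≤-trans (v<N 0) (m≤m+n N N)
    digit<N+N (suc k) = ≤-<-trans (m∸n≤m (v (suc k) + N) (v k)) (+-monoˡ-< N (v<N (suc k)))

  digitSum-digit : ∀ r → digitSum digit r ≡ v r + r * N
  digitSum-digit zero    = sym (+-identityʳ (v 0))
  digitSum-digit (suc r) = begin
    digitSum digit r + digit (suc r) ≡⟨ cong (_+ digit (suc r)) (digitSum-digit r) ⟩
    (v r + r * N) + digit (suc r)    ≡⟨ cong (_+ digit (suc r)) (+-comm (v r) (r * N)) ⟩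
    (r * N + v r) + digit (suc r)    ≡⟨ +-assoc (r * N) (v r) (digit (suc r)) ⟩
    r * N + (v r + digit (suc r))    ≡⟨ cong (_+_ (r * N)) (m+[n∸m]≡n v[r]≤v[1+r]+N) ⟩
    r * N + (v (suc r) + N)          ≡⟨ +-comm (r * N) (v (suc r) + N) ⟩
    (v (suc r) + N) + r * N          ≡⟨ +-assoc (v (suc r)) N (r * N) ⟩
    v (suc r) + (N + r * N)          ∎
    where
    open ≡-Reasoning
    v[r]≤v[1+r]+N : v r ≤ v (suc r) + N
    v[r]≤v[1+r]+N = ≤-trans (<⇒≤ (v<N r)) (m≤n+m N (v (suc r)))

  code : ℕ
  code = numeral digit N

  code%B^[1+r]%N≡v : ∀ r → r ≤ N → let instance _ = m^n≢0 B (suc r) in code % B ^ suc r % N ≡ v r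
  code%B^[1+r]%N≡v r r≤N = begin
    numeral digit N % B ^ suc r % N           ≡⟨ cong (λ n → numeral digit n % B ^ suc r % N) (m∸n+n≡m r≤N) ⟨
    numeral digit (N ∸ r + r) % B ^ suc r % N ≡⟨ cong (_% N) (numeral-%-prefix digit<B (N ∸ r) r) ⟩
    numeral digit r % N                       ≡⟨ numeral-%-digitSum N ([m+kn]%n≡m%n 1 2 N) digit r ⟩
    digitSum digit r % N                      ≡⟨ cong (_% N) (digitSum-digit r) ⟩
    (v r + r * N) % N                         ≡⟨ [m+kn]%n≡m%n (v r) r N ⟩
    v r % N                                   ≡⟨ m<n⇒m%n≡m (v<N r) ⟩
    v r                                       ∎
    where
    open ≡-Reasoning
    instance _ = m^n≢0 B (suc r)

-- Registers: 0 x, 1 m, 2 ℓ = T₀[x], 3 r = m mod ℓ, 4 p = T₁[r], 5 a = T₂[x],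
-- 6 a mod p, 7 n = T₃[x], 8 (a mod p) mod n.
program : List (Instr 4)
program = look 0F 0 ∷ mod 1 2 ∷ look 1F 3 ∷ look 2F 0 ∷ mod 5 4 ∷ look 3F 0 ∷ mod 6 7 ∷ []

run-program : (T : Fin 4 → Table) (x m ℓ p a n : ℕ) .{{ℓ≢0 : NonZero ℓ}} .{{p≢0 : NonZero p}} .{{n≢0 : NonZero n}} →
              nth (T 0F) x ≡ just (+ ℓ) → nth (T 1F) (m % ℓ) ≡ just (+ p) →
              nth (T 2F) x ≡ just (+ a) → nth (T 3F) x ≡ just (+ n) →
              run T program (+ x) (+ m) ≡ just (+ (a % p % n))
run-program T x m ℓ p a n {{ℓ≢0}} {{p≢0}} {{n≢0}} T₀[x] T₁[r] T₂[x] T₃[x]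
  rewrite T₀[x] | modℤ-+ m ℓ {{ℓ≢0}} | T₁[r]
        | T₂[x] | modℤ-+ a p {{p≢0}} | T₃[x] | modℤ-+ (a % p) n {{n≢0}}
        = refl

module Construction (N : ℕ) .{{_ : NonZero N}} (f : Permutation′ N) where

  g : Fin N → Fin N
  g = f ⟨$⟩ʳ_

  open module PeriodOf (x : Fin N) = Period (injective⇒period (Injection.injective (↔⇒↣ f)) x)

  module Orbit (x : Fin N) = Telescoping N (λ k → toℕ (iter g k x)) (λ k → toℕ<n (iter g k x))
  open Orbit using (code)

  B : ℕ
  B = 1 + 2 * N

  tables : Fin 4 → Table
  tables 0F = tabulate (λ x → + period x)
  tables 1F = tabulate {n = N} ((λ r → + B ^ suc r) ∘ toℕ)
  tables 2F = tabulate (λ x → + code x)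
  tables 3F = tabulate {n = N} (λ _ → + N)

  tables-length : (t : Fin 4) → length (tables t) ≤ N
  tables-length 0F = ≤-reflexive (length-tabulate _)
  tables-length 1F = ≤-reflexive (length-tabulate _)
  tables-length 2F = ≤-reflexive (length-tabulate _)
  tables-length 3F = ≤-reflexive (length-tabulate _)

  run-program-iter : (m : ℕ) (x : Fin N) → run tables program (+ toℕ x) (+ m) ≡ just (+ toℕ (iter g m x))
  run-program-iter m x = begin
    run tables program (+ toℕ x) (+ m) ≡⟨ run-program tables (toℕ x) m (period x) (B ^ suc r) (code x) N
                                             (nth-tabulate _ x) (nth-tabulate-toℕ (λ k → + B ^ suc k) r<N)
                                             (nth-tabulate _ x) (nth-tabulate _ x) ⟩
    just (+ (code x % B ^ suc r % N))  ≡⟨ cong (just ∘ +_) (Orbit.code%B^[1+r]%N≡v x r (<⇒≤ r<N)) ⟩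
    just (+ toℕ (iter g r x))          ≡⟨ cong (just ∘ +_ ∘ toℕ) (iter-%-period g {period x} (iter-period x) m) ⟨
    just (+ toℕ (iter g m x))          ∎
    where
    open ≡-Reasoning
    instance _ = period-nonZero x
    r = m % period x
    instance _ = m^n≢0 B (suc r)
    r<N : r < N
    r<N = <-≤-trans (m%n<n m (period x)) (period≤n x)

theorem2p4 : (N : ℕ) → 1 ≤ N → (f : Permutation′ N) →
    Σ (Fin 4 → Table) λ T →
      ((t : Fin 4) → length (T t) ≤ N) ×
      Σ (List (Instr 4)) λ P →
        #lookups P ≤ 5 × #arith P ≤ 5 ×
        ((m : ℕ) (x : Fin N) →
          run T P (+ toℕ x) (+ m) ≡ just (+ toℕ (iter (f ⟨$⟩ʳ_) m x)))
theorem2p4 N 1≤N f = tables , tables-length , program , m≤m+n 4 1 , m≤m+n 3 2 , run-program-iter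
  where
  instance _ = >-nonZero 1≤N
  open Construction N f
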